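{- Let $k\ge r\ge 3$ and $t\ge0$ be integers and let $\pi\in\mathbb{C}(k,r)$ be such that both $2t+1$ and $2t+2$ occur as parts of $\pi$. Then every part $2t+2$ of $\pi$ has a mark in $GG(\pi)$ strictly greater than the mark of $2t+1$ in $GG(\pi)$.
   Context: A partition is a finite non-increasing sequence of positive integers. $\mathbb{C}(k,r)$ is the set of partitions $\pi=(\pi_1,\dots,\pi_\ell)$ with no repeated odd part, $\pi_i\ge\pi_{i+k-1}+2$ for $1\le i\le\ell-k+1$ (strict if $\pi_i$ even), and at most $r-1$ parts $\le2$. Göllnitz–Gordon marking $GG(\pi)$: marks (positive integers) are assigned to the parts from smallest to largest (i.e. to $\pi_\ell,\pi_{\ell-1},\dots,\pi_1$), each as small as possible subject to: the mark of $\pi_i$ differs from the marks of all parts $\pi_g$, $g>i$, with $\pi_i-\pi_g\le2$, the inequality being strict if $\pi_i$ is odd. -}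

module Defs where

open import Data.Nat using (ℕ; zero; suc; _+_; _*_; _∸_; _≤_; _<_; _%_; _≤?_)
open import Data.List using (List; length; lookup; filter)
open import Data.Fin using (Fin; toℕ)
open import Data.Product using (_×_; ∃-syntax)
open import Relation.Binary.PropositionalEquality using (_≡_)
open import Relation.Nullary using (¬_)

-- a partition is written as a list π = (π₁ , … , π_ℓ); index i : Fin ℓ is 0-based
Part : List ℕ → Set
Part π = Fin (length π)

_!_ : (π : List ℕ) → Part π → ℕ
π ! i = lookup π i

Odd : ℕ → Set
Odd n = n % 2 ≡ 1

Even : ℕ → Set
Even n = n % 2 ≡ 0

IsPartition : List ℕ → Set
IsPartition π =
  (∀ (i : Part π) → 1 ≤ π ! i) ×
  (∀ (i j : Part π) → toℕ i < toℕ j → π ! j ≤ π ! i)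

-- the difference condition π_i ≥ π_{i+k-1} + 2, strict if π_i even
GapOK : ℕ → ℕ → Set
GapOK a b = (b + 2 ≤ a) × (Even a → b + 2 < a)

InC : ℕ → ℕ → List ℕ → Set
InC k r π =
  IsPartition π ×
  (∀ (i j : Part π) → toℕ i < toℕ j → π ! i ≡ π ! j → Even (π ! i)) ×
  (∀ (i j : Part π) → toℕ j ≡ toℕ i + (k ∸ 1) → GapOK (π ! i) (π ! j)) ×
  (length (filter (_≤? 2) π) ≤ r ∸ 1)

-- the part π_i conflicts with a (later, hence not larger) part π_g:
-- π_i - π_g ≤ 2, strictly if π_i is odd
Conflict : ℕ → ℕ → Set
Conflict a b = (a ≤ b + 2) × (Odd a → a < b + 2)

Blocked : (π : List ℕ) → (Part π → ℕ) → Part π → ℕ → Set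
Blocked π μ i m = ∃[ g ] (toℕ i < toℕ g × Conflict (π ! i) (π ! g) × μ g ≡ m)

-- μ is the Göllnitz–Gordon marking GG(π): marks assigned from the smallest part
-- to the largest, each the least positive integer not used by a conflicting
-- earlier-marked (i.e. later-indexed) part.
IsGG : (π : List ℕ) → (Part π → ℕ) → Set
IsGG π μ = ∀ (i : Part π) →
  (1 ≤ μ i) ×
  (¬ Blocked π μ i (μ i)) ×
  (∀ m → 1 ≤ m → m < μ i → Blocked π μ i m)

{-# OPTIONS --safe #-}
module Submission where

open import Defs
open import Data.Nat using (ℕ; _+_; _*_; _≤_; _<_; _<?_)
open import Data.Nat.Properties
open import Data.Nat.DivMod using (%-remove-+ˡ)
open import Data.Nat.Divisibility using (m∣m*n)
open import Data.List using (List)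
open import Data.Fin using (toℕ)
open import Data.Fin.Properties using (toℕ-injective)
open import Data.Product using (_×_; _,_; proj₁; proj₂)
open import Data.Sum using (inj₁; inj₂)
open import Data.Empty using (⊥-elim)
open import Relation.Nullary using (¬_; yes; no)
open import Relation.Binary.Definitions using (tri<; tri≈; tri>)
open import Relation.Binary.PropositionalEquality using (_≡_; refl; sym; trans; cong; subst₂)

-- Parts are non-increasing, so a part 2t+2 comes before the part 2t+1 and is marked
-- after it. Every part conflicting with 2t+1 also conflicts with 2t+2, and so does 2t+1
-- itself. Greedily, each mark below that of 2t+1 is held by a part conflicting with 2t+1,
-- so none of these marks, nor the mark of 2t+1, is available to 2t+2.

odd-2t+1 : ∀ t → Odd (2 * t + 1)
odd-2t+1 t = %-remove-+ˡ 1 (m∣m*n t)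

even-2t+2 : ∀ t → Even (2 * t + 2)
even-2t+2 t = %-remove-+ˡ 2 (m∣m*n t)

even⇒¬odd : ∀ {n} → Even n → ¬ Odd n
even⇒¬odd even odd with () ← trans (sym even) odd

conflict-of-even : ∀ {a b} → Even a → a ≤ b + 2 → Conflict a b
conflict-of-even {a} even a≤b+2 = a≤b+2 , λ odd → ⊥-elim (even⇒¬odd {a} even odd)

Dominates : ℕ → ℕ → Set
Dominates a c = Conflict a c × (∀ b → Conflict c b → Conflict a b)

2t+2-dominates-2t+1 : ∀ t → Dominates (2 * t + 2) (2 * t + 1)
2t+2-dominates-2t+1 t =
  conflict-of-even (even-2t+2 t) (+-monoˡ-≤ 2 (m≤m+n (2 * t) 1)) ,
  λ b c → conflict-of-even (even-2t+2 t)
            (subst₂ _≤_ (sym (+-suc (2 * t) 1)) refl (proj₂ c (odd-2t+1 t)))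

larger-part-comes-first : ∀ {π} → IsPartition π → {i j : Part π} →
  π ! i < π ! j → toℕ j < toℕ i
larger-part-comes-first {π} (_ , nonIncreasing) {i} {j} πi<πj with <-cmp (toℕ i) (toℕ j)
... | tri< i<j _ _ = ⊥-elim (<⇒≱ πi<πj (nonIncreasing i j i<j))
... | tri≈ _ i≡j _ = ⊥-elim (<-irrefl (cong (π !_) (toℕ-injective i≡j)) πi<πj)
... | tri> _ _ j<i = j<i

Blocked-transfer : ∀ {π μ i j m} → toℕ j < toℕ i →
  (∀ b → Conflict (π ! i) b → Conflict (π ! j) b) →
  Blocked π μ i m → Blocked π μ j m
Blocked-transfer j<i extend (g , i<g , conflict , μg≡m) =
  g , <-trans j<i i<g , extend _ conflict , μg≡m

dominating-part-has-larger-mark : ∀ {π μ} → IsGG π μ → {i j : Part π} →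
  toℕ j < toℕ i → Dominates (π ! j) (π ! i) → μ i < μ j
dominating-part-has-larger-mark {π} {μ} gg {i} {j} j<i (conflict , extend) with μ i <? μ j
... | yes μi<μj = μi<μj
... | no μi≮μj = ⊥-elim (proj₁ (proj₂ (gg j)) (ownMarkBlocked (≮⇒≥ μi≮μj)))
  where
  ownMarkBlocked : μ j ≤ μ i → Blocked π μ j (μ j)
  ownMarkBlocked μj≤μi with m≤n⇒m<n∨m≡n μj≤μi
  ... | inj₂ μj≡μi = i , j<i , conflict , sym μj≡μi
  ... | inj₁ μj<μi =
    Blocked-transfer {π} j<i extend (proj₂ (proj₂ (gg i)) (μ j) (proj₁ (gg j)) μj<μi)

lemma2p10 : (k r t : ℕ) → 3 ≤ r → r ≤ k → (π : List ℕ) → InC k r π →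
    (μ : Part π → ℕ) → IsGG π μ →
    (i j : Part π) → π ! i ≡ 2 * t + 1 → π ! j ≡ 2 * t + 2 → μ i < μ j
lemma2p10 k r t _ _ π (partition , _) μ gg i j πi≡2t+1 πj≡2t+2 =
  dominating-part-has-larger-mark {π} gg j<i
    (subst₂ Dominates (sym πj≡2t+2) (sym πi≡2t+1) (2t+2-dominates-2t+1 t))
  where
  j<i : toℕ j < toℕ i
  j<i = larger-part-comes-first {π} partition
          (subst₂ _<_ (sym πi≡2t+1) (sym πj≡2t+2) (+-monoʳ-< (2 * t) (n<1+n 1)))
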